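{- Let $n>1$ be an integer, and suppose the global array $d$ satisfies $d_j=1$ for all $j>1$. Then the call $\mathrm{RecDesc}(2n,n,1)$ results in exactly $p(n)+p(n-1)$ invocations of $\mathrm{RecDesc}$ in total, counting the initial call and all recursive calls.
   Context: $p(n)$ denotes the number of partitions of $n$. The recursive procedure $\mathrm{RecDesc}(n,m,k)$, with preconditions $1\le m\le n$ and $d_j=1$ for all $j>k$, operates on a global array $d$ as follows: 1. $d_k\leftarrow m$. 2. If $n=m$ or $m=1$, visit $\langle d_1,\dots,d_{k+n-m}\rangle$. 3. Otherwise: for $x=1$ to $\min(m,n-m)$, call $\mathrm{RecDesc}(n-m,x,k+1)$; then set $d_k\leftarrow 1$. The call $\mathrm{RecDesc}(2n,n,1)$ generates all descending compositions of $2n$ with first part $n$. Omitting $d_1$ from each visited sequence therefore generates all descending compositions of $n$. -}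

module Defs where

open import Data.Nat using (ℕ; zero; suc; _+_; _∸_; _≤_; _<_; _≤?_; _≥_; _≥?_; _⊓_)
open import Data.Nat.Properties using (_≟_)
open import Data.Bool using (if_then_else_)
open import Data.List using (List; []; _∷_; _++_; map; concatMap; filter; length; applyUpTo)
open import Data.Nat.ListAction using (sum)
open import Data.List.Relation.Unary.Linked using (Linked; linked?)
open import Data.List.Relation.Unary.All using (All; all?)
open import Data.Product using (_×_)
open import Data.Sum using (_⊎_)
open import Relation.Nullary using (¬_; Dec; does)
open import Relation.Nullary.Decidable using (_×-dec_)
open import Relation.Binary.PropositionalEquality using (_≡_)

IsPartition : ℕ → List ℕ → Set
IsPartition n xs = Linked _≥_ xs × All (λ x → 1 ≤ x) xs × sum xs ≡ n

isPartition? : (n : ℕ) (xs : List ℕ) → Dec (IsPartition n xs)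
isPartition? n xs =
  linked? (λ a b → a ≥? b) xs ×-dec (all? (λ x → 1 ≤? x) xs ×-dec (sum xs ≟ n))

listsUpTo : List ℕ → ℕ → List (List ℕ)
listsUpTo xs zero    = [] ∷ []
listsUpTo xs (suc l) = [] ∷ concatMap (λ x → map (x ∷_) (listsUpTo xs l)) xs

-- Candidates: lists of length ≤ n with entries in 1..n.
-- Every partition of n occurs among them exactly once.
candidates : ℕ → List (List ℕ)
candidates n = listsUpTo (applyUpTo suc n) n

p : ℕ → ℕ
p n = length (filter (isPartition? n) (candidates n))

-- The procedure RecDesc(n, m, k), as a big-step operational semantics.
-- The global array d is modelled as a function ℕ → ℕ (index 1 = d₁;
-- index 0 is unused).

Array : Set
Array = ℕ → ℕ

set : Array → ℕ → ℕ → Array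
set d k v j = if does (j ≟ k) then v else d j

prefix : Array → ℕ → List ℕ
prefix d L = applyUpTo (λ i → d (suc i)) L

mutual
  -- RecDesc n m k d d' vs c :
  --   the call RecDesc(n,m,k) started with array d terminates with array d',
  --   visits the sequences vs (in order), and performs c invocations of
  --   RecDesc in total (this call together with all nested calls).
  data RecDesc : ℕ → ℕ → ℕ → Array → Array → List (List ℕ) → ℕ → Set where
    leaf : ∀ {n m k d} → (n ≡ m ⊎ m ≡ 1) →
           RecDesc n m k d (set d k m) (prefix (set d k m) (k + n ∸ m) ∷ []) 1
    node : ∀ {n m k d d' vs c} → ¬ (n ≡ m) → ¬ (m ≡ 1) →
           Loop (n ∸ m) 1 (m ⊓ (n ∸ m)) (suc k) (set d k m) d' vs c →
           RecDesc n m k d (set d' k 1) vs (suc c)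

  -- Loop n' x hi k d d' vs c : the loop "for x' = x to hi, call RecDesc(n',x',k)".
  data Loop : ℕ → ℕ → ℕ → ℕ → Array → Array → List (List ℕ) → ℕ → Set where
    done : ∀ {n' x hi k d} → hi < x → Loop n' x hi k d d [] 0
    step : ∀ {n' x hi k d d₁ d₂ vs₁ vs₂ c₁ c₂} → x ≤ hi →
           RecDesc n' x k d d₁ vs₁ c₁ →
           Loop n' (suc x) hi k d₁ d₂ vs₂ c₂ →
           Loop n' x hi k d d₂ (vs₁ ++ vs₂) (c₁ + c₂)

module Submission where

-- Write q r m for the number of partitions of r into parts of size at most m;
-- splitting off the largest part x gives
--   q r m = [r = 0] + Σ_{x=1}^{min(m,r)} q (r - x) x,      and p n = q n n.
-- For m ≥ 1 and r = n' - m, the call tree of RecDesc(n', m, k) has q r m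
-- leaves (the visited compositions) and  internal r m = q (r - 1) m  internal
-- nodes when r ≥ 1, m ≥ 2 (none otherwise), so it makes
--   calls n' m = q r m + internal r m   invocations.
--
-- The theorem then
-- follows from  calls (2n) n = q n n + q (n-1) n = p n + p (n-1).

open import Defs
open import Data.Nat using (ℕ; zero; suc; _+_; _*_; _∸_; _≤_; _<_; _≥_; _⊓_; z≤n; s≤s; _≡ᵇ_; _≤ᵇ_)
open import Data.Nat.Properties
open import Data.Nat.Induction using (<-rec)
open import Data.Nat.ListAction using (sum)
open import Data.Bool using (Bool; true; false; T; _∧_; if_then_else_)
open import Data.Bool.Properties using (T-∧; T-≡)
open import Data.List using (List; []; _∷_; _++_; map; concatMap; filter; length; applyUpTo)
open import Data.List.Properties using (map-applyUpTo)
open import Data.List.Relation.Unary.Linked using (Linked; []; [-]; _∷_) renaming (tail to linked-tail)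
open import Data.List.Relation.Unary.Linked.Properties using (Linked⇒All; Linked⇒AllPairs)
open import Data.List.Relation.Unary.AllPairs using (_∷_)
open import Data.List.Relation.Unary.All as All using (All; []; _∷_)
open import Data.Product using (Σ; _×_; _,_; proj₁)
open import Data.Sum using (inj₁; inj₂)
open import Data.Empty using (⊥-elim)
open import Function using (_∘_)
open import Function.Bundles using (Equivalence)
open import Relation.Nullary using (yes; no; Dec; does)
open import Relation.Unary using (Decidable)
open import Relation.Binary.PropositionalEquality
  using (_≡_; refl; sym; trans; cong; cong₂; subst; module ≡-Reasoning)
open import Algebra.Properties.CommutativeSemigroup +-commutativeSemigroup using (interchange)

open Equivalence using (to; from)

σ : (ℕ → ℕ) → ℕ → ℕ
σ h K = sum (applyUpTo (h ∘ suc) K)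

σ-zero : ∀ {h} K → (∀ x → 1 ≤ x → x ≤ K → h x ≡ 0) → σ h K ≡ 0
σ-zero zero    _  = refl
σ-zero (suc K) h0 =
  cong₂ _+_ (h0 1 (s≤s z≤n) (s≤s z≤n)) (σ-zero K (λ x _ x≤K → h0 (suc x) (s≤s z≤n) (s≤s x≤K)))

σ-trunc : ∀ {h h'} K K' → K' ≤ K → (∀ x → 1 ≤ x → x ≤ K' → h x ≡ h' x) →
          (∀ x → K' < x → x ≤ K → h x ≡ 0) → σ h K ≡ σ h' K'
σ-trunc K zero z≤n _ h0 = σ-zero K h0
σ-trunc (suc K) (suc K') (s≤s K'≤K) agree h0 =
  cong₂ _+_ (agree 1 (s≤s z≤n) (s≤s z≤n))
    (σ-trunc K K' K'≤K (λ x _ x≤K' → agree (suc x) (s≤s z≤n) (s≤s x≤K'))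
                       (λ x K'<x x≤K → h0 (suc x) (s≤s K'<x) (s≤s x≤K)))

σ-cong : ∀ {h h'} K → (∀ x → 1 ≤ x → x ≤ K → h x ≡ h' x) → σ h K ≡ σ h' K
σ-cong K agree = σ-trunc K K ≤-refl agree (λ x K<x x≤K → ⊥-elim (<⇒≱ K<x x≤K))

σ-+ : ∀ h g K → σ (λ x → h x + g x) K ≡ σ h K + σ g K
σ-+ h g zero    = refl
σ-+ h g (suc K) = trans (cong (h 1 + g 1 +_) (σ-+ (h ∘ suc) (g ∘ suc) K))
                        (interchange (h 1) (g 1) (σ (h ∘ suc) K) (σ (g ∘ suc) K))

σ-snoc : ∀ h K → σ h (suc K) ≡ σ h K + h (suc K)
σ-snoc h zero    = +-comm (h 1) 0
σ-snoc h (suc K) = trans (cong (h 1 +_) (σ-snoc (h ∘ suc) K)) (sym (+-assoc (h 1) _ _))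

ind : Bool → ℕ
ind true  = 1
ind false = 0

-- Restricted partition numbers: q r m counts the partitions of r into parts of
-- size at most m.  Choosing the largest part x gives the recurrence below; it
-- is computed with an explicit fuel argument, which is irrelevant once f > r.
qᶠ : ℕ → ℕ → ℕ → ℕ
qᶠ zero    r m = 0
qᶠ (suc f) r m = ind (r ≡ᵇ 0) + σ (λ x → qᶠ f (r ∸ x) x) (m ⊓ r)

q : ℕ → ℕ → ℕ
q r m = qᶠ (suc r) r m

∸-decreasing : ∀ {x r} → 1 ≤ x → x ≤ r → r ∸ x < r
∸-decreasing {x} {r} 1≤x x≤r = ∸-monoʳ-< {r} {x} {0} 1≤x x≤r

⊓-bound : ∀ {x m r} → 1 ≤ x → x ≤ m ⊓ r → r ∸ x < r
⊓-bound {x} {m} {r} 1≤x x≤m⊓r = ∸-decreasing 1≤x (≤-trans x≤m⊓r (m⊓n≤n m r))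

qᶠ-fuel : ∀ f g r m → r < f → r < g → qᶠ f r m ≡ qᶠ g r m
qᶠ-fuel (suc f) (suc g) r m (s≤s r≤f) (s≤s r≤g) =
  cong (ind (r ≡ᵇ 0) +_) (σ-cong (m ⊓ r) λ x 1≤x x≤m⊓r →
    let r∸x<r = ⊓-bound {x} {m} {r} 1≤x x≤m⊓r in
    qᶠ-fuel f g (r ∸ x) x (<-≤-trans r∸x<r r≤f) (<-≤-trans r∸x<r r≤g))

q-unfold : ∀ r m → q r m ≡ ind (r ≡ᵇ 0) + σ (λ x → q (r ∸ x) x) (m ⊓ r)
q-unfold r m = cong (ind (r ≡ᵇ 0) +_) (σ-cong (m ⊓ r) λ x 1≤x x≤m⊓r →
  qᶠ-fuel r (suc (r ∸ x)) (r ∸ x) x (⊓-bound {x} {m} {r} 1≤x x≤m⊓r) ≤-refl)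

q-zero : ∀ m → q 0 m ≡ 1
q-zero m = trans (q-unfold 0 m) (cong (λ K → 1 + σ (λ x → q (0 ∸ x) x) K) (⊓-zeroʳ m))

-- Only the partition 1 + ⋯ + 1 has all parts ≤ 1.
q-one : ∀ r → q r 1 ≡ 1
q-one zero    = q-zero 1
q-one (suc r) = trans (q-unfold (suc r) 1) (trans (+-identityʳ (q r 1)) (q-one r))

q-saturate : ∀ r m → r ≤ m → q r m ≡ q r r
q-saturate r m r≤m = begin
  q r m                                           ≡⟨ q-unfold r m ⟩
  ind (r ≡ᵇ 0) + σ (λ x → q (r ∸ x) x) (m ⊓ r)   ≡⟨ cong (λ K → ind (r ≡ᵇ 0) + σ (λ x → q (r ∸ x) x) K) m⊓r≡r⊓r ⟩
  ind (r ≡ᵇ 0) + σ (λ x → q (r ∸ x) x) (r ⊓ r)   ≡⟨ sym (q-unfold r r) ⟩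
  q r r                                           ∎
  where
  open ≡-Reasoning
  m⊓r≡r⊓r : m ⊓ r ≡ r ⊓ r
  m⊓r≡r⊓r = trans (m≥n⇒m⊓n≡n r≤m) (sym (⊓-idem r))

count : (List ℕ → Bool) → List (List ℕ) → ℕ
count g []       = 0
count g (ys ∷ L) = ind (g ys) + count g L

length-filter : ∀ {P : List ℕ → Set} (P? : Decidable P) L →
                length (filter P? L) ≡ count (λ ys → does (P? ys)) L
length-filter P? []       = refl
length-filter P? (ys ∷ L) with does (P? ys)
... | true  = cong suc (length-filter P? L)
... | false = length-filter P? L

count-cong : ∀ {g g'} → (∀ ys → g ys ≡ g' ys) → ∀ L → count g L ≡ count g' L
count-cong g≗g' []       = refl
count-cong g≗g' (ys ∷ L) = cong₂ _+_ (cong ind (g≗g' ys)) (count-cong g≗g' L)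

count-++ : ∀ g A B → count g (A ++ B) ≡ count g A + count g B
count-++ g []       B = refl
count-++ g (ys ∷ A) B = trans (cong (ind (g ys) +_) (count-++ g A B)) (sym (+-assoc (ind (g ys)) _ _))

count-concatMap : ∀ g (f : ℕ → List (List ℕ)) U →
                  count g (concatMap f U) ≡ sum (map (count g ∘ f) U)
count-concatMap g f []      = refl
count-concatMap g f (x ∷ U) = trans (count-++ g (f x) (concatMap f U)) (cong (count g (f x) +_) (count-concatMap g f U))

count-map-∷ : ∀ g x L → count g (map (x ∷_) L) ≡ count (g ∘ (x ∷_)) L
count-map-∷ g x []       = refl
count-map-∷ g x (ys ∷ L) = cong (ind (g (x ∷ ys)) +_) (count-map-∷ g x L)

count-∧ : ∀ b g L → count (λ ys → b ∧ g ys) L ≡ (if b then count g L else 0)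
count-∧ true  g L        = refl
count-∧ false g []       = refl
count-∧ false g (ys ∷ L) = count-∧ false g L

does-reflects : ∀ {P : Set} (P? : Dec P) b → (P → T b) → (T b → P) → does P? ≡ b
does-reflects (yes _)  true  _    _     = refl
does-reflects (yes pf) false toT  _     = ⊥-elim (toT pf)
does-reflects (no _)   false _    _     = refl
does-reflects (no ¬pf) true  _    fromT = ⊥-elim (¬pf (fromT _))

-- fits r m ys tests whether ys is a partition of r with all parts ≤ m: each
-- part x must be admissible (1 ≤ x ≤ m, x ≤ what remains of r), and the rest
-- must be a partition of r - x into parts ≤ x.
admissible : ℕ → ℕ → ℕ → Bool
admissible r m x = (1 ≤ᵇ x) ∧ (x ≤ᵇ m) ∧ (x ≤ᵇ r)

fits : ℕ → ℕ → List ℕ → Bool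
fits r m []       = r ≡ᵇ 0
fits r m (x ∷ ys) = admissible r m x ∧ fits (r ∸ x) x ys

≥-trans : ∀ {x y z} → x ≥ y → y ≥ z → x ≥ z
≥-trans x≥y y≥z = ≤-trans y≥z x≥y

tail≤head : ∀ {x ys} → Linked _≥_ (x ∷ ys) → All (_≤ x) ys
tail≤head l with Linked⇒AllPairs ≥-trans l
... | ys≤x ∷ _ = ys≤x

parts≤sum : ∀ {ys} → Linked _≥_ ys → All (_≤ sum ys) ys
parts≤sum {[]}     _ = []
parts≤sum {x ∷ ys} l = Linked⇒All ≥-trans (m≤m+n x (sum ys)) l

admissible-complete : ∀ {r m x} → 1 ≤ x → x ≤ m → x ≤ r → T (admissible r m x)
admissible-complete 1≤x x≤m x≤r = from T-∧ (≤⇒≤ᵇ 1≤x , from T-∧ (≤⇒≤ᵇ x≤m , ≤⇒≤ᵇ x≤r))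

admissible-sound : ∀ r m x → T (admissible r m x) → 1 ≤ x × x ≤ m × x ≤ r
admissible-sound r m x t with to T-∧ t
... | t₁ , t₂₃ with to T-∧ t₂₃
... | t₂ , t₃ = ≤ᵇ⇒≤ 1 x t₁ , ≤ᵇ⇒≤ x m t₂ , ≤ᵇ⇒≤ x r t₃

fits-complete : ∀ m ys → Linked _≥_ ys → All (1 ≤_) ys → All (_≤ m) ys → T (fits (sum ys) m ys)
fits-complete m []       _ _            _          = _
fits-complete m (x ∷ ys) l (1≤x ∷ ys≥1) (x≤m ∷ _) =
  from T-∧ ( admissible-complete 1≤x x≤m (m≤m+n x (sum ys))
           , subst (λ r → T (fits r x ys)) (sym (m+n∸m≡n x (sum ys)))
               (fits-complete x ys (linked-tail l) ys≥1 (tail≤head l)))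

fits-sound : ∀ r m ys → T (fits r m ys) → IsPartition r ys × All (_≤ m) ys
fits-sound r m []       t = ([] , [] , sym (≡ᵇ⇒≡ r 0 t)) , []
fits-sound r m (x ∷ ys) t with to T-∧ t
... | adm , t-rest with admissible-sound r m x adm | fits-sound (r ∸ x) x ys t-rest
... | 1≤x , x≤m , x≤r | (linked , ys≥1 , sum≡r∸x) , ys≤x =
  (cons-linked ys≤x linked , 1≤x ∷ ys≥1 , trans (cong (x +_) sum≡r∸x) (m+[n∸m]≡n x≤r))
  , x≤m ∷ All.map (λ y≤x → ≤-trans y≤x x≤m) ys≤x
  where
  cons-linked : ∀ {zs} → All (_≤ x) zs → Linked _≥_ zs → Linked _≥_ (x ∷ zs)
  cons-linked []        _ = [-]
  cons-linked (z≤x ∷ _) l = z≤x ∷ l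

admissible-beyond : ∀ r m x → m ⊓ r < x → admissible r m x ≡ false
admissible-beyond r m x m⊓r<x with admissible r m x in eq
... | false = refl
... | true with admissible-sound r m x (subst T (sym eq) _)
...   | _ , x≤m , x≤r = ⊥-elim (<⇒≱ m⊓r<x (⊓-glb x≤m x≤r))

count-first : ∀ r m x L →
  count (fits r m) (map (x ∷_) L) ≡ (if admissible r m x then count (fits (r ∸ x) x) L else 0)
count-first r m x L = trans (count-map-∷ (fits r m) x L) (count-∧ (admissible r m x) (fits (r ∸ x) x) L)

count-candidates : ∀ l N r m → r ≤ l → m ⊓ r ≤ N →
  count (fits r m) (listsUpTo (applyUpTo suc N) l) ≡ q r m
count-candidates zero    N .zero m z≤n _ = sym (q-zero m)
count-candidates (suc l) N r m r≤1+l m⊓r≤N = begin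
  ind (r ≡ᵇ 0) + count (fits r m) (concatMap (λ x → map (x ∷_) lists) U)
    ≡⟨ cong (ind (r ≡ᵇ 0) +_) (count-concatMap (fits r m) (λ x → map (x ∷_) lists) U) ⟩
  ind (r ≡ᵇ 0) + sum (map starting U)
    ≡⟨ cong (λ xs → ind (r ≡ᵇ 0) + sum xs) (map-applyUpTo suc starting N) ⟩
  ind (r ≡ᵇ 0) + σ starting N
    ≡⟨ cong (ind (r ≡ᵇ 0) +_) (σ-trunc N (m ⊓ r) m⊓r≤N agree beyond) ⟩
  ind (r ≡ᵇ 0) + σ (λ x → q (r ∸ x) x) (m ⊓ r)
    ≡⟨ sym (q-unfold r m) ⟩
  q r m ∎
  where
  open ≡-Reasoning
  U : List ℕ
  U = applyUpTo suc N
  lists : List (List ℕ)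
  lists = listsUpTo U l
  starting : ℕ → ℕ
  starting x = count (fits r m) (map (x ∷_) lists)
  agree : ∀ x → 1 ≤ x → x ≤ m ⊓ r → starting x ≡ q (r ∸ x) x
  agree x 1≤x x≤m⊓r
    rewrite count-first r m x lists
          | to T-≡ (admissible-complete {r} {m} 1≤x (≤-trans x≤m⊓r (m⊓n≤m m r)) (≤-trans x≤m⊓r (m⊓n≤n m r)))
    = count-candidates l N (r ∸ x) x
        (≤-pred (<-≤-trans (⊓-bound {x} {m} {r} 1≤x x≤m⊓r) r≤1+l))
        (≤-trans (m⊓n≤m x (r ∸ x)) (≤-trans x≤m⊓r m⊓r≤N))
  beyond : ∀ x → m ⊓ r < x → x ≤ N → starting x ≡ 0
  beyond x m⊓r<x _ rewrite count-first r m x lists | admissible-beyond r m x m⊓r<x = refl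

p≡q : ∀ n → p n ≡ q n n
p≡q n = begin
  length (filter (isPartition? n) (candidates n))               ≡⟨ length-filter (isPartition? n) (candidates n) ⟩
  count (λ ys → does (isPartition? n ys)) (candidates n)         ≡⟨ count-cong decides-fits (candidates n) ⟩
  count (fits n n) (candidates n)                                ≡⟨ count-candidates n n n n ≤-refl (m⊓n≤n n n) ⟩
  q n n                                                          ∎
  where
  open ≡-Reasoning
  decides-fits : ∀ ys → does (isPartition? n ys) ≡ fits n n ys
  decides-fits ys = does-reflects (isPartition? n ys) (fits n n ys)
    (λ { (linked , ys≥1 , refl) → fits-complete n ys linked ys≥1 (parts≤sum linked) })
    (λ t → proj₁ (fits-sound n n ys t))

-- internal r m: the number of calls RecDesc(r + m, m, k) makes that do not
-- visit (the non-leaf nodes of its call tree), namely q (r - 1) m when r ≥ 1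
-- and m ≥ 2.  The clauses split on m first, so internal r 1 reduces to 0.
internal : ℕ → ℕ → ℕ
internal r       zero          = 0
internal r       (suc zero)    = 0
internal zero    (suc (suc m)) = 0
internal (suc r) (suc (suc m)) = q r (suc (suc m))

internal-zero : ∀ m → internal 0 m ≡ 0
internal-zero zero          = refl
internal-zero (suc zero)    = refl
internal-zero (suc (suc m)) = refl

calls : ℕ → ℕ → ℕ
calls n m = q (n ∸ m) m + internal (n ∸ m) m

-- Internal nodes of a non-leaf call with r = s + 1 and m ≥ 2: itself plus those
-- of its children RecDesc(r, x, k+1), 1 ≤ x ≤ min(m, r), which total
-- internal r m = q s m.  The child x = 1 is a leaf; after the shift x = y + 1
-- the remaining terms are the recurrence of q s m without its first term
-- q (s - 1) 1 = 1.
internal-rec : ∀ s m → 2 ≤ m → suc (σ (λ x → internal (suc s ∸ x) x) (m ⊓ suc s)) ≡ q s m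
internal-rec zero    (suc (suc m)) (s≤s (s≤s _)) = sym (q-zero (suc (suc m)))
internal-rec (suc t) (suc (suc m)) (s≤s (s≤s _)) = begin
  suc (σ (λ y → internal (suc t ∸ y) (suc y)) (suc m ⊓ suc t))
    ≡⟨ cong suc (σ-trunc (suc m ⊓ suc t) (suc m ⊓ t) (⊓-monoʳ-≤ (suc m) (n≤1+n t)) agree beyond) ⟩
  suc (σ (λ y → q (t ∸ y) (suc y)) (suc m ⊓ t))
    ≡⟨ cong (_+ σ (λ y → q (t ∸ y) (suc y)) (suc m ⊓ t)) (sym (q-one t)) ⟩
  σ (λ x → q (suc t ∸ x) x) (suc (suc m ⊓ t))
    ≡⟨ sym (q-unfold (suc t) (suc (suc m))) ⟩
  q (suc t) (suc (suc m)) ∎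
  where
  open ≡-Reasoning
  agree : ∀ y → 1 ≤ y → y ≤ suc m ⊓ t → internal (suc t ∸ y) (suc y) ≡ q (t ∸ y) (suc y)
  agree (suc y) _ y≤ = cong (λ r → internal r (suc (suc y))) (+-∸-assoc 1 (≤-trans y≤ (m⊓n≤n (suc m) t)))
  beyond : ∀ y → suc m ⊓ t < y → y ≤ suc m ⊓ suc t → internal (suc t ∸ y) (suc y) ≡ 0
  beyond y bound<y y≤ = trans (cong (λ r → internal r (suc y)) (m≤n⇒m∸n≡0 t<y)) (internal-zero (suc y))
    where
    t<y : t < y
    t<y = ≰⇒> (λ y≤t → <⇒≱ bound<y (⊓-glb (≤-trans y≤ (m⊓n≤m (suc m) (suc t))) y≤t))

calls-rec : ∀ r m → 2 ≤ m → suc (σ (calls r) (m ⊓ r)) ≡ q r m + internal r m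
calls-rec zero    m 2≤m = trans (cong (λ K → suc (σ (calls 0) K)) (⊓-zeroʳ m))
                                (sym (cong₂ _+_ (q-zero m) (internal-zero m)))
calls-rec (suc s) m 2≤m = begin
  suc (σ (λ x → leaves x + inner x) (m ⊓ suc s))           ≡⟨ cong suc (σ-+ leaves inner (m ⊓ suc s)) ⟩
  suc (σ leaves (m ⊓ suc s) + σ inner (m ⊓ suc s))       ≡⟨ sym (+-suc (σ leaves (m ⊓ suc s)) _) ⟩
  σ leaves (m ⊓ suc s) + suc (σ inner (m ⊓ suc s))       ≡⟨ cong₂ _+_ (sym (q-unfold (suc s) m)) (internal-rec s m 2≤m) ⟩
  q (suc s) m + q s m                                     ≡⟨ cong (q (suc s) m +_) (internal-succ s m 2≤m) ⟩
  q (suc s) m + internal (suc s) m                        ∎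
  where
  open ≡-Reasoning
  leaves inner : ℕ → ℕ
  leaves x = q (suc s ∸ x) x
  inner x = internal (suc s ∸ x) x
  internal-succ : ∀ r k → 2 ≤ k → q r k ≡ internal (suc r) k
  internal-succ r (suc (suc k)) (s≤s (s≤s _)) = refl

mutual
  calls-count : ∀ {n m k d d' vs c} → RecDesc n m k d d' vs c → 1 ≤ m → c ≡ calls n m
  calls-count {n} (leaf (inj₁ refl)) _ =
    sym (trans (cong (λ r → q r n + internal r n) (n∸n≡0 n)) (cong₂ _+_ (q-zero n) (internal-zero n)))
  calls-count {n} (leaf (inj₂ refl)) _ =
    sym (trans (+-identityʳ (q (n ∸ 1) 1)) (q-one (n ∸ 1)))
  calls-count {n} {m} (node n≢m m≢1 loop) 1≤m =
    trans (cong suc (loop-count loop z≤n)) (calls-rec (n ∸ m) m (≤∧≢⇒< 1≤m (m≢1 ∘ sym)))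

  loop-count : ∀ {n j hi k d d' vs c} → Loop n (suc j) hi k d d' vs c → j ≤ hi →
               σ (calls n) j + c ≡ σ (calls n) hi
  loop-count {n} {j} (done hi<1+j) j≤hi with ≤-antisym j≤hi (≤-pred hi<1+j)
  ... | refl = +-identityʳ (σ (calls n) j)
  loop-count {n} {j} {hi} (step {c₁ = c₁} {c₂ = c₂} j<hi first rest) _ = begin
    σ (calls n) j + (c₁ + c₂)                 ≡⟨ sym (+-assoc (σ (calls n) j) c₁ c₂) ⟩
    σ (calls n) j + c₁ + c₂                   ≡⟨ cong (λ c → σ (calls n) j + c + c₂) (calls-count first (s≤s z≤n)) ⟩
    σ (calls n) j + calls n (suc j) + c₂      ≡⟨ cong (_+ c₂) (sym (σ-snoc (calls n) j)) ⟩
    σ (calls n) (suc j) + c₂                  ≡⟨ loop-count rest j<hi ⟩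
    σ (calls n) hi                            ∎
    where open ≡-Reasoning

Run : ℕ → ℕ → ℕ → Array → Set
Run n m k d = Σ Array λ d' → Σ (List (List ℕ)) λ vs → Σ ℕ λ c → RecDesc n m k d d' vs c

RunLoop : ℕ → ℕ → ℕ → ℕ → Array → Set
RunLoop n x hi k d = Σ Array λ d' → Σ (List (List ℕ)) λ vs → Σ ℕ λ c → Loop n x hi k d d' vs c

run-loop : ∀ {n hi} → (∀ j → suc j ≤ hi → ∀ k d → Run n (suc j) k d) →
           ∀ t j k d → t + j ≡ hi → RunLoop n (suc j) hi k d
run-loop body zero j k d refl = d , [] , 0 , done ≤-refl
run-loop {hi = hi} body (suc t) j k d t+1+j≡hi =
  let (d₁ , vs₁ , c₁ , first) = body j j<hi k d
      (d₂ , vs₂ , c₂ , rest)  = run-loop body t (suc j) k d₁ (trans (+-suc t j) t+1+j≡hi)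
  in d₂ , vs₁ ++ vs₂ , c₁ + c₂ , step j<hi first rest
  where
  j<hi : suc j ≤ hi
  j<hi = subst (suc j ≤_) t+1+j≡hi (s≤s (m≤n+m j t))

-- Every call RecDesc(n, m, k) terminates: the recursive calls are made on
-- n - m < n, so a run is built by well-founded recursion on n.
run : ∀ n m k d → Run n m k d
run = <-rec (λ n → ∀ m k d → Run n m k d) run-from
  where
  run-from : ∀ n → (∀ {n'} → n' < n → ∀ m k d → Run n' m k d) → ∀ m k d → Run n m k d
  run-from n recurse m k d with n ≟ m | m ≟ 1
  ... | yes n≡m | _       = _ , _ , _ , leaf (inj₁ n≡m)
  ... | no _    | yes m≡1 = _ , _ , _ , leaf (inj₂ m≡1)
  ... | no n≢m  | no m≢1  =
    let (d' , vs , c , loop) = run-loop body hi 0 (suc k) (set d k m) (+-identityʳ hi)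
    in set d' k 1 , vs , suc c , node n≢m m≢1 loop
    where
    hi : ℕ
    hi = m ⊓ (n ∸ m)
    body : ∀ j → suc j ≤ hi → ∀ k d → Run (n ∸ m) (suc j) k d
    body j j<hi = recurse (∸-decreasing 1≤m m≤n) (suc j)
      where
      1≤m : 1 ≤ m
      1≤m = ≤-trans (s≤s z≤n) (≤-trans j<hi (m⊓n≤m m (n ∸ m)))
      1≤n∸m : 1 ≤ n ∸ m
      1≤n∸m = ≤-trans (s≤s z≤n) (≤-trans j<hi (m⊓n≤n m (n ∸ m)))
      m≤n : m ≤ n
      m≤n = <⇒≤ (m∸n≢0⇒n<m (n>0⇒n≢0 1≤n∸m))

calls-double : ∀ n → 1 < n → calls (2 * n) n ≡ p n + p (n ∸ 1)
calls-double (suc zero)      (s≤s ())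
calls-double n@(suc (suc k)) _ = begin
  q (2 * n ∸ n) n + internal (2 * n ∸ n) n   ≡⟨ cong (λ r → q r n + internal r n) 2n∸n≡n ⟩
  q n n + q (suc k) n                         ≡⟨ cong₂ _+_ (sym (p≡q n)) (q-saturate (suc k) n (n≤1+n (suc k))) ⟩
  p n + q (suc k) (suc k)                     ≡⟨ cong (p n +_) (sym (p≡q (suc k))) ⟩
  p n + p (suc k)                             ∎
  where
  open ≡-Reasoning
  2n∸n≡n : 2 * n ∸ n ≡ n
  2n∸n≡n = trans (cong (λ n' → n + n' ∸ n) (+-identityʳ n)) (m+n∸m≡n n n)

-- The run exists, and any run makes calls (2n) n invocations; the count does
-- not depend on the initial array.
theorem2p3 : (n : ℕ) → 1 < n → (d : Array) → (∀ j → 1 < j → d j ≡ 1) →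
    ( Σ Array λ d' → Σ (List (List ℕ)) λ vs → Σ ℕ λ c →
        RecDesc (2 * n) n 1 d d' vs c × c ≡ p n + p (n ∸ 1) )
  × (∀ d' vs c → RecDesc (2 * n) n 1 d d' vs c → c ≡ p n + p (n ∸ 1))
theorem2p3 n 1<n d _ =
  (let (d' , vs , c , R) = run (2 * n) n 1 d in d' , vs , c , R , counted d' vs c R) , counted
  where
  counted : ∀ d' vs c → RecDesc (2 * n) n 1 d d' vs c → c ≡ p n + p (n ∸ 1)
  counted d' vs c R = trans (calls-count R (<⇒≤ 1<n)) (calls-double n 1<n)
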